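{- Let $h \ge 2$ and let $Q_h$ be the $h$-dimensional hypercube. Then (i) $\mu(Q_h) \le 2\mu(Q_{h-1})$; (ii) $\mu_t(Q_h) \le 2\mu_t(Q_{h-1})$; (iii) $\mu_o(Q_h) \le 2\mu_o(Q_{h-1})$; (iv) $\mu_d(Q_h) \le 2\mu_d(Q_{h-1})$.
   Context: The hypercube $Q_h$ has vertex set $\{0,1\}^h$, two binary strings being adjacent iff they differ in exactly one position. For a graph $G$, $M \subseteq V(G)$ and $u,v \in V(G)$, a $u,v$-path is $M$-free if it contains no vertex of $M \setminus \{u,v\}$; $u,v$ are $M$-visible if some shortest $u,v$-path in $G$ is $M$-free. Let $\overline{M} = V(G)\setminus M$. $M$ is a mutual-visibility set if every $u,v \in M$ are $M$-visible; a total mutual-visibility set if every $u,v \in V(G)$ are $M$-visible; an outer mutual-visibility set if every $u,v\in M$ are $M$-visible and every $u \in M$, $v \in \overline M$ are $M$-visible; a dual mutual-visibility set if every $u,v \in M$ are $M$-visible and every $u,v \in \overline M$ are $M$-visible. $\mu(G)$, $\mu_t(G)$, $\mu_o(G)$, $\mu_d(G)$ denote the maximum cardinality of a mutual-visibility, total, outer, and dual mutual-visibility set of $G$, respectively. -}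

module Defs where

open import Data.Nat using (ℕ; zero; suc; _≤_)
open import Data.Bool using (Bool)
open import Data.Fin using (Fin)
open import Data.Vec using (Vec; lookup)
open import Data.List using (List; []; _∷_; length)
open import Data.List.Membership.Propositional using (_∈_)
open import Data.List.Relation.Unary.Unique.Propositional using (Unique)
open import Data.Product using (Σ; ∃; ∃-syntax; _×_; _,_)
open import Data.Sum using (_⊎_)
open import Relation.Nullary using (¬_)
open import Relation.Binary.PropositionalEquality using (_≡_)

module Graph {V : Set} (Adj : V → V → Set) where

  -- u,v-walks (a shortest walk is automatically a path)
  data Walk : V → V → Set where
    []  : ∀ {u} → Walk u u
    _∷_ : ∀ {u w v} → Adj u w → Walk w v → Walk u v

  len : ∀ {u v} → Walk u v → ℕ
  len []      = 0
  len (_ ∷ p) = suc (len p)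

  verts : ∀ {u v} → Walk u v → List V
  verts {u} []      = u ∷ []
  verts {u} (_ ∷ p) = u ∷ verts p

  Shortest : ∀ {u v} → Walk u v → Set
  Shortest {u} {v} p = ∀ (q : Walk u v) → len p ≤ len q

  Free : List V → ∀ {u v} → Walk u v → Set
  Free M {u} {v} p = ∀ x → x ∈ verts p → x ∈ M → (x ≡ u) ⊎ (x ≡ v)

  Visible : List V → V → V → Set
  Visible M u v = Σ (Walk u v) λ p → Shortest p × Free M p

  MutualVis : List V → Set
  MutualVis M = Unique M × (∀ u v → u ∈ M → v ∈ M → Visible M u v)

  TotalMutualVis : List V → Set
  TotalMutualVis M = Unique M × (∀ u v → Visible M u v)

  OuterMutualVis : List V → Set
  OuterMutualVis M = Unique M
    × (∀ u v → u ∈ M → v ∈ M → Visible M u v)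
    × (∀ u v → u ∈ M → ¬ (v ∈ M) → Visible M u v)

  DualMutualVis : List V → Set
  DualMutualVis M = Unique M
    × (∀ u v → u ∈ M → v ∈ M → Visible M u v)
    × (∀ u v → ¬ (u ∈ M) → ¬ (v ∈ M) → Visible M u v)

  IsMaxCard : (List V → Set) → ℕ → Set
  IsMaxCard P n = (∃[ M ] (P M × length M ≡ n)) × (∀ M → P M → length M ≤ n)

QV : ℕ → Set
QV h = Vec Bool h

QAdj : (h : ℕ) → QV h → QV h → Set
QAdj h x y = ∃[ i ] (¬ (lookup x i ≡ lookup y i)
                     × (∀ (j : Fin h) → ¬ (j ≡ i) → lookup x j ≡ lookup y j))

module Q (h : ℕ) = Graph (QAdj h)

μ≡ : ℕ → ℕ → Set
μ≡ h n = Q.IsMaxCard h (Q.MutualVis h) n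

μt≡ : ℕ → ℕ → Set
μt≡ h n = Q.IsMaxCard h (Q.TotalMutualVis h) n

μo≡ : ℕ → ℕ → Set
μo≡ h n = Q.IsMaxCard h (Q.OuterMutualVis h) n

μd≡ : ℕ → ℕ → Set
μd≡ h n = Q.IsMaxCard h (Q.DualMutualVis h) n

{-# OPTIONS --safe #-}
module Submission where

-- Split Q_h by the first coordinate into two copies of Q_(h-1). A shortest walk between two
-- vertices with the same first coordinate never flips it, since dropping the flips would give a
-- strictly shorter walk; so it is a shortest walk inside one copy, and its vertices in M are those
-- of the corresponding slice of M. Hence both slices of a (total, outer, dual) mutual-visibility
-- set of Q_h are sets of the same kind in Q_(h-1), and |M| = |M₀| + |M₁|.

open import Defs
open import Data.Nat using (ℕ; suc; _≤_; _*_; _∸_; _+_; z≤n; s≤s)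
open import Data.Nat.Properties using (≤-trans; m≤n⇒m≤1+n; 1+n≰n; +-mono-≤; +-suc; +-identityʳ; module ≤-Reasoning)
open import Data.Product using (_×_; _,_)
open import Data.Bool using (Bool; true; false; _≟_)
open import Data.Fin using (zero; suc)
open import Data.Fin.Properties using (suc-injective)
open import Data.Vec using (Vec; _∷_; lookup; tabulate; head; tail)
open import Data.Vec.Properties using (tabulate∘lookup; tabulate-cong)
open import Data.List using (List; []; _∷_; length)
open import Data.List.Membership.Propositional using (_∈_; _∉_)
open import Data.List.Relation.Unary.Any using (here; there)
open import Data.List.Relation.Unary.All as All using ()
open import Data.List.Relation.Unary.AllPairs using (_∷_)
open import Data.List.Relation.Unary.Unique.Propositional using (Unique; [])
import Data.Sum as Sum
open import Function using (_∘_)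
open import Relation.Nullary using (yes; no; contradiction)
open import Relation.Binary.PropositionalEquality using (_≡_; _≢_; _≗_; refl; sym; cong; subst; module ≡-Reasoning)

lookup-≗⇒≡ : ∀ {A : Set} {n} {x y : Vec A n} → lookup x ≗ lookup y → x ≡ y
lookup-≗⇒≡ {x = x} {y} x≗y = begin
  x                   ≡⟨ sym (tabulate∘lookup x) ⟩
  tabulate (lookup x) ≡⟨ tabulate-cong x≗y ⟩
  tabulate (lookup y) ≡⟨ tabulate∘lookup y ⟩
  y                   ∎
  where open ≡-Reasoning

module _ {n : ℕ} where

  slice : Bool → List (Vec Bool (suc n)) → List (Vec Bool n)
  slice c [] = []
  slice c ((d ∷ x) ∷ M) with d ≟ c
  ... | yes _ = x ∷ slice c M
  ... | no _  = slice c M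

  ∈-slice⁻ : ∀ {c M w} → w ∈ slice c M → (c ∷ w) ∈ M
  ∈-slice⁻ {c} {(d ∷ x) ∷ M} w∈ with d ≟ c | w∈
  ... | yes refl | here refl = here refl
  ... | yes refl | there w∈′ = there (∈-slice⁻ w∈′)
  ... | no _     | w∈′       = there (∈-slice⁻ w∈′)

  ∈-slice⁺ : ∀ {c M w} → (c ∷ w) ∈ M → w ∈ slice c M
  ∈-slice⁺ {c} {(d ∷ x) ∷ M} cw∈ with d ≟ c | cw∈
  ... | yes refl | here refl  = here refl
  ... | yes refl | there cw∈′ = there (∈-slice⁺ cw∈′)
  ... | no d≢c   | here refl  = contradiction refl d≢c
  ... | no _     | there cw∈′ = ∈-slice⁺ cw∈′

  slice-unique : ∀ {c M} → Unique M → Unique (slice c M)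
  slice-unique {c} {[]} [] = []
  slice-unique {c} {(d ∷ x) ∷ M} (dx∉M ∷ M-unique) with d ≟ c
  ... | yes refl = All.tabulate (λ y∈ x≡y → All.lookup dx∉M (∈-slice⁻ y∈) (cong (c ∷_) x≡y))
                 ∷ slice-unique M-unique
  ... | no _     = slice-unique M-unique

  length-slices : ∀ M → length M ≡ length (slice false M) + length (slice true M)
  length-slices [] = refl
  length-slices ((false ∷ x) ∷ M) = cong suc (length-slices M)
  length-slices ((true ∷ x) ∷ M) = begin
    suc (length M)                                           ≡⟨ cong suc (length-slices M) ⟩
    suc (length (slice false M) + length (slice true M))     ≡⟨ +-suc _ _ ⟨
    length (slice false M) + suc (length (slice true M))     ∎
    where open ≡-Reasoning

module _ {n : ℕ} where
  private
    module Qₙ = Q n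
    module Qₙ₊₁ = Q (suc n)

  data HeadStep : QV (suc n) → QV (suc n) → Set where
    flip-head : ∀ {a b x} → HeadStep (a ∷ x) (b ∷ x)
    keep-head : ∀ {a x y} → QAdj n x y → HeadStep (a ∷ x) (a ∷ y)

  headStep : ∀ {u w} → QAdj (suc n) u w → HeadStep u w
  headStep {a ∷ x} {b ∷ y} (zero , _ , agree) with lookup-≗⇒≡ {x = x} {y} (λ j → agree (suc j) (λ ()))
  ... | refl = flip-head
  headStep {a ∷ x} {b ∷ y} (suc i , differ , agree) with agree zero (λ ())
  ... | refl = keep-head (i , differ , λ j j≢i → agree (suc j) (j≢i ∘ suc-injective))

  cons-adj : ∀ c {x y} → QAdj n x y → QAdj (suc n) (c ∷ x) (c ∷ y)
  cons-adj c (i , differ , agree) = suc i , differ , agree′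
    where
    agree′ : ∀ j → j ≢ suc i → lookup (c ∷ _) j ≡ lookup (c ∷ _) j
    agree′ zero    _     = refl
    agree′ (suc j) j≢1+i = agree j (j≢1+i ∘ cong suc)

  cons-walk : ∀ c {x y} → Qₙ.Walk x y → Qₙ₊₁.Walk (c ∷ x) (c ∷ y)
  cons-walk c Qₙ.[]      = Qₙ₊₁.[]
  cons-walk c (e Qₙ.∷ p) = cons-adj c e Qₙ₊₁.∷ cons-walk c p

  len-cons-walk : ∀ c {x y} (p : Qₙ.Walk x y) → Qₙ₊₁.len (cons-walk c p) ≡ Qₙ.len p
  len-cons-walk c Qₙ.[]      = refl
  len-cons-walk c (e Qₙ.∷ p) = cong suc (len-cons-walk c p)

  project : ∀ {u v} → Qₙ₊₁.Walk u v → Qₙ.Walk (tail u) (tail v)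
  project Qₙ₊₁.[] = Qₙ.[]
  project {u} (Qₙ₊₁._∷_ {w = w} e p) with headStep {u} {w} e
  ... | flip-head   = project p
  ... | keep-head e′ = e′ Qₙ.∷ project p

  len-project : ∀ {u v} (p : Qₙ₊₁.Walk u v) → Qₙ.len (project p) ≤ Qₙ₊₁.len p
  len-project Qₙ₊₁.[] = z≤n
  len-project {u} (Qₙ₊₁._∷_ {w = w} e p) with headStep {u} {w} e
  ... | flip-head   = m≤n⇒m≤1+n (len-project p)
  ... | keep-head _ = s≤s (len-project p)

  project-verts : ∀ {u v} (p : Qₙ₊₁.Walk u v) → Qₙ₊₁.len p ≤ Qₙ.len (project p)
                → ∀ {w} → w ∈ Qₙ.verts (project p) → (head u ∷ w) ∈ Qₙ₊₁.verts p
  project-verts {_ ∷ _} Qₙ₊₁.[] _ (here refl) = here refl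
  project-verts {u} (Qₙ₊₁._∷_ {w = w} e p) p≤ w∈ with headStep {u} {w} e
  ... | flip-head   = contradiction (≤-trans p≤ (len-project p)) 1+n≰n
  project-verts {_ ∷ _} (e Qₙ₊₁.∷ p) p≤ (here refl)  | keep-head _ = here refl
  project-verts         (e Qₙ₊₁.∷ p) (s≤s p≤) (there w∈) | keep-head _ = there (project-verts p p≤ w∈)

  slice-visible : ∀ {c M u v} → Qₙ₊₁.Visible M (c ∷ u) (c ∷ v) → Qₙ.Visible (slice c M) u v
  slice-visible {c} {M} (p , p-shortest , p-free) = project p , q-shortest , q-free
    where
    p≤ : ∀ r → Qₙ₊₁.len p ≤ Qₙ.len r
    p≤ r = subst (Qₙ₊₁.len p ≤_) (len-cons-walk c r) (p-shortest (cons-walk c r))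

    q-shortest : Qₙ.Shortest (project p)
    q-shortest r = ≤-trans (len-project p) (p≤ r)

    q-free : Qₙ.Free (slice c M) (project p)
    q-free w w∈q w∈M = Sum.map (cong tail) (cong tail)
      (p-free (c ∷ w) (project-verts p (p≤ (project p)) w∈q) (∈-slice⁻ w∈M))

  slice-visible-within : ∀ {c M} → (∀ u v → u ∈ M → v ∈ M → Qₙ₊₁.Visible M u v)
                       → ∀ u v → u ∈ slice c M → v ∈ slice c M → Qₙ.Visible (slice c M) u v
  slice-visible-within M-vis _ _ u∈ v∈ = slice-visible (M-vis _ _ (∈-slice⁻ u∈) (∈-slice⁻ v∈))

  slice-mutualVis : ∀ c {M} → Qₙ₊₁.MutualVis M → Qₙ.MutualVis (slice c M)
  slice-mutualVis c (M-unique , M-vis) = slice-unique M-unique , slice-visible-within M-vis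

  slice-totalMutualVis : ∀ c {M} → Qₙ₊₁.TotalMutualVis M → Qₙ.TotalMutualVis (slice c M)
  slice-totalMutualVis c (M-unique , M-vis) = slice-unique M-unique , λ _ _ → slice-visible (M-vis _ _)

  slice-outerMutualVis : ∀ c {M} → Qₙ₊₁.OuterMutualVis M → Qₙ.OuterMutualVis (slice c M)
  slice-outerMutualVis c (M-unique , M-vis , M-vis-out) =
    slice-unique M-unique , slice-visible-within M-vis ,
    λ _ _ u∈ v∉ → slice-visible (M-vis-out _ _ (∈-slice⁻ u∈) (v∉ ∘ ∈-slice⁺))

  slice-dualMutualVis : ∀ c {M} → Qₙ₊₁.DualMutualVis M → Qₙ.DualMutualVis (slice c M)
  slice-dualMutualVis c (M-unique , M-vis , M̄-vis) =
    slice-unique M-unique , slice-visible-within M-vis ,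
    λ _ _ u∉ v∉ → slice-visible (M̄-vis _ _ (u∉ ∘ ∈-slice⁺) (v∉ ∘ ∈-slice⁺))

  maxCard-≤-double : ∀ {P P′ a b} → (∀ c {M} → P M → P′ (slice c M))
                   → Qₙ₊₁.IsMaxCard P a → Qₙ.IsMaxCard P′ b → a ≤ 2 * b
  maxCard-≤-double {b = b} slice-P ((M , P-M , refl) , _) (_ , max) = begin
    length M                                       ≡⟨ length-slices M ⟩
    length (slice false M) + length (slice true M) ≤⟨ +-mono-≤ (max _ (slice-P false P-M)) (max _ (slice-P true P-M)) ⟩
    b + b                                          ≡⟨ cong (b +_) (+-identityʳ b) ⟨
    2 * b                                          ∎
    where open ≤-Reasoning

mainTheorem1 : ∀ (h : ℕ) → 2 ≤ h
    → (∀ a b → μ≡ h a → μ≡ (h ∸ 1) b → a ≤ 2 * b)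
    × (∀ a b → μt≡ h a → μt≡ (h ∸ 1) b → a ≤ 2 * b)
    × (∀ a b → μo≡ h a → μo≡ (h ∸ 1) b → a ≤ 2 * b)
    × (∀ a b → μd≡ h a → μd≡ (h ∸ 1) b → a ≤ 2 * b)
-- The bound holds for every h ≥ 1; the hypothesis 2 ≤ h only excludes h = 0, where h ∸ 1 truncates.
mainTheorem1 (suc n) _ =
    (λ _ _ → maxCard-≤-double slice-mutualVis)
  , (λ _ _ → maxCard-≤-double slice-totalMutualVis)
  , (λ _ _ → maxCard-≤-double slice-outerMutualVis)
  , (λ _ _ → maxCard-≤-double slice-dualMutualVis)
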